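{- Let $G$ be a properly edge-coloured graph with minimum degree $\delta(G)>0$ and let $k\geq 2$ be an integer. Then $h_{2k}(1,2k)\leq \dfrac{h_{2k-2}}{\delta(G)}$.
   Context: An edge-colouring $c$ is proper if edges sharing a vertex get distinct colours. For $m\geq 2$, a homomorphic cycle of length $m$ in $G$ is a sequence $(u_0,\dots,u_{m-1})$ of vertices with $u_iu_{i+1}\in E(G)$ for all $i$, indices modulo $m$ (for $m=2$, an ordered pair of adjacent vertices). Its weight is $1/\prod_{i=0}^{m-1}d_G(u_i)$. $h_m$ is the sum of the weights of all homomorphic cycles of length $m$, and for positive integers $i,j$, $h_{2k}(i,j)$ is the sum of the weights of homomorphic cycles $(u_0,\dots,u_{2k-1})$ of length $2k$ with $c(u_{i-1}u_i)=c(u_{j-1}u_j)$, indices modulo $2k$. -}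

module Defs where

open import Data.Nat using (ℕ; zero; suc; _*_; _∸_; _≤_; _<_)
open import Data.Nat.DivMod using (_mod_)
open import Data.Integer using (+_)
open import Data.Bool using (Bool; true; false; if_then_else_; _∧_)
open import Data.Fin using (Fin)
open import Data.List using (List; foldr; map; allFin)
open import Data.Vec.Functional using (_∷_)
open import Data.Rational using (ℚ; 0ℚ; _+_; _/_)
open import Relation.Binary.PropositionalEquality using (_≡_; _≢_)
open import Data.Product using (Σ; _×_)

record IsGraph {n : ℕ} (adj : Fin n → Fin n → Bool) : Set where
  field
    symmetric : ∀ u v → adj u v ≡ true → adj v u ≡ true
    loopless  : ∀ u → adj u u ≡ false

-- An edge-colouring: c u v is the colour of the edge uv (values on non-edges
-- are irrelevant).  It is well-defined on edges (symmetric) and proper.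
record IsProperEdgeColouring {n : ℕ} (adj : Fin n → Fin n → Bool)
                             (c : Fin n → Fin n → ℕ) : Set where
  field
    onEdges : ∀ u v → adj u v ≡ true → c u v ≡ c v u
    proper  : ∀ u v w → adj u v ≡ true → adj u w ≡ true → v ≢ w → c u v ≢ c u w

sumFin : (n : ℕ) → (Fin n → ℚ) → ℚ
sumFin n f = foldr _+_ 0ℚ (map f (allFin n))

sumFinℕ : (n : ℕ) → (Fin n → ℕ) → ℕ
sumFinℕ n f = foldr Data.Nat._+_ 0 (map f (allFin n))

sumSeq : (n m : ℕ) → ((Fin m → Fin n) → ℚ) → ℚ
sumSeq n zero    f = f (λ ())
sumSeq n (suc m) f = sumFin n (λ a → sumSeq n m (λ u → f (a ∷ u)))

deg : {n : ℕ} → (Fin n → Fin n → Bool) → Fin n → ℕ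
deg {n} adj u = sumFinℕ n (λ v → if adj u v then 1 else 0)

IsMinDegree : {n : ℕ} → (Fin n → Fin n → Bool) → ℕ → Set
IsMinDegree {n} adj δ = Σ (Fin n) (λ u → deg adj u ≡ δ) × (∀ v → δ ≤ deg adj v)

-- 1/d as a rational (convention 1/0 := 0; only used for d > 0)
inv : ℕ → ℚ
inv zero    = 0ℚ
inv (suc d) = (+ 1) / suc d

allB : (m : ℕ) → (Fin m → Bool) → Bool
allB m p = foldr _∧_ true (map p (allFin m))

prodFin : (m : ℕ) → (Fin m → ℕ) → ℕ
prodFin m f = foldr _*_ 1 (map f (allFin m))

module _ {n : ℕ} (adj : Fin n → Fin n → Bool) where

  at : {m' : ℕ} → (Fin (suc m') → Fin n) → ℕ → Fin n
  at {m'} u i = u (i mod (suc m'))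

  isHomCycle : {m' : ℕ} → (Fin (suc m') → Fin n) → Bool
  isHomCycle {m'} u = allB (suc m') (λ i → adj (u i) (at u (suc (Data.Fin.toℕ i))))

  weight : {m : ℕ} → (Fin m → Fin n) → ℚ
  weight {m} u = inv (prodFin m (λ i → deg adj (u i)))

  h : ℕ → ℚ
  h zero     = 0ℚ
  h (suc m') = sumSeq n (suc m') (λ u → if isHomCycle u then weight u else 0ℚ)

  hPair : (Fin n → Fin n → ℕ) → ℕ → ℕ → ℕ → ℚ
  hPair c zero     i j = 0ℚ
  hPair c (suc m') i j =
    sumSeq n (suc m') (λ u →
      if isHomCycle u ∧ (c (at u (i ∸ 1)) (at u i) Data.Nat.≡ᵇ c (at u (j ∸ 1)) (at u j))
      then weight u else 0ℚ)

-- Properness forces a cycle (u₀, …, u_{m-1}) with c(u₀u₁) = c(u_{m-1}u₀) to have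
-- u_{m-1} = u₁: it is a cycle (u₁, …, u_{m-2}) of length m - 2 with a detour
-- u₁ → u₀ → u₁ inserted, and its weight is that of the shorter cycle times
-- 1/(d(u₀) d(u₁)).  Summed over the neighbours u₀ of u₁ these factors contribute at most
-- d(u₁) · 1/(δ d(u₁)) = 1/δ, whence h_m(1,m) ≤ h_{m-2}/δ for every m ≥ 3.
module Submission where

open import Algebra.Bundles using (CommutativeRing)
open import Data.Bool using (Bool; true; false; if_then_else_; _∧_)
open import Data.Bool.Properties using (T-≡; ∧-conicalˡ; ∧-conicalʳ)
open import Data.Empty using (⊥-elim)
open import Data.Fin using (Fin; zero; suc; toℕ; fromℕ; inject₁; punchIn; _≟_)
open import Data.Fin.Properties using (toℕ-injective; toℕ-fromℕ<; toℕ<n; toℕ-fromℕ; toℕ-inject₁; punchInᵢ≢i)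
open import Data.Integer as ℤ using (+≤+)
import Data.Integer.Properties as ℤ
open import Data.List as List using (foldr; map; allFin; tabulate)
import Data.List.Properties as Listₚ
import Data.List.Relation.Unary.All as All
open import Data.List.Relation.Unary.All.Properties using (all⁺; all⁻)
open import Data.List.Membership.Propositional.Properties using (∈-allFin)
open import Data.Nat as ℕ using (ℕ; zero; suc; z≤n; s≤s)
open import Data.Nat.DivMod using (_mod_; m<n⇒m%n≡m; n%n≡0)
import Data.Nat.Properties as ℕ
open import Data.Product using (_×_; _,_; proj₁; proj₂)
open import Data.Rational using (ℚ; 0ℚ; 1ℚ; _+_; _*_; _≤_; toℚᵘ; NonNegative; nonNegative)
open import Data.Rational.Literals using (fromℤ)
open import Data.Rational.Properties
  using (toℚᵘ-injective; toℚᵘ-fromℚᵘ; toℚᵘ-homo-+; toℚᵘ-homo-*; toℚᵘ-cancel-≤;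
         normalize-nonNeg; nonNegative⁻¹; nonNeg*nonNeg⇒nonNeg; *-monoʳ-≤-nonNeg;
         +-mono-≤; +-identityʳ; *-identityˡ; *-zeroˡ; *-zeroʳ; *-comm;
         ≤-refl; ≤-reflexive; module ≤-Reasoning; +-*-commutativeRing)
open import Algebra.Properties.CommutativeSemigroup (CommutativeRing.*-commutativeSemigroup +-*-commutativeRing)
  using (xy∙z≈xz∙y)
open import Algebra.Properties.Semiring.Sum (CommutativeRing.semiring +-*-commutativeRing)
  using (sum; sum-syntax; sum-cong-≗; ∑-comm; sum-remove; sum-replicate-zero; *-distribˡ-sum; *-distribʳ-sum)
open import Data.Rational.Unnormalised as ℚᵘ using (mkℚᵘ; *≡*; *≤*)
import Data.Rational.Unnormalised.Properties as ℚᵘ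
open import Data.Vec.Functional using (_∷_; head; tail; init; last)
open import Function using (_∘_; id; _⇔_; mk⇔; Equivalence)
open import Relation.Binary.PropositionalEquality
open import Relation.Nullary using (¬_; yes; no)

open import Defs

private variable
  A : Set
  m : ℕ

toℚ : ℕ → ℚ
toℚ m = fromℤ (ℤ.+ m)

toℚ-homo-+ : ∀ m n → toℚ (m ℕ.+ n) ≡ toℚ m + toℚ n
toℚ-homo-+ m n = toℚᵘ-injective (ℚᵘ.≃-sym (ℚᵘ.≃-trans (toℚᵘ-homo-+ (toℚ m) (toℚ n))
  (*≡* (cong₂ ℤ._*_ (cong₂ ℤ._+_ (ℤ.*-identityʳ (ℤ.+ m)) (ℤ.*-identityʳ (ℤ.+ n))) refl))))

toℚᵘ-inv : ∀ d → toℚᵘ (inv (suc d)) ℚᵘ.≃ mkℚᵘ (ℤ.+ 1) d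
toℚᵘ-inv d = toℚᵘ-fromℚᵘ (mkℚᵘ (ℤ.+ 1) d)

inv-homo-* : ∀ a b → inv (a ℕ.* b) ≡ inv a * inv b
inv-homo-* zero    b    = sym (*-zeroˡ (inv b))
inv-homo-* (suc a) zero rewrite ℕ.*-zeroʳ a = sym (*-zeroʳ (inv (suc a)))
inv-homo-* (suc a) (suc b) = toℚᵘ-injective (begin
  toℚᵘ (inv (suc a ℕ.* suc b))               ≈⟨ toℚᵘ-inv (b ℕ.+ a ℕ.* suc b) ⟩
  mkℚᵘ (ℤ.+ 1) a ℚᵘ.* mkℚᵘ (ℤ.+ 1) b         ≈⟨ ℚᵘ.*-cong (toℚᵘ-inv a) (toℚᵘ-inv b) ⟨
  toℚᵘ (inv (suc a)) ℚᵘ.* toℚᵘ (inv (suc b)) ≈⟨ toℚᵘ-homo-* (inv (suc a)) (inv (suc b)) ⟨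
  toℚᵘ (inv (suc a) * inv (suc b))           ∎)
  where open ℚᵘ.≃-Reasoning

inv-nonNeg : ∀ d → NonNegative (inv d)
inv-nonNeg zero    = _
inv-nonNeg (suc d) = normalize-nonNeg 1 (suc d)

inv-antimono-≤ : ∀ {a b} → 0 ℕ.< a → a ℕ.≤ b → inv b ≤ inv a
inv-antimono-≤ {suc a} {suc b} _ a≤b = toℚᵘ-cancel-≤
  (ℚᵘ.≤-respˡ-≃ (ℚᵘ.≃-sym (toℚᵘ-inv b)) (ℚᵘ.≤-respʳ-≃ (ℚᵘ.≃-sym (toℚᵘ-inv a))
    (*≤* (+≤+ (ℕ.+-monoˡ-≤ 0 a≤b)))))

-- For d = 0 the product is 0 because inv 0 = 0.
toℚ*inv≤1 : ∀ d → toℚ d * inv d ≤ 1ℚ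
toℚ*inv≤1 zero    = nonNegative⁻¹ 1ℚ
toℚ*inv≤1 (suc d) = ≤-reflexive (toℚᵘ-injective (ℚᵘ.≃-trans
  (toℚᵘ-homo-* (toℚ (suc d)) (inv (suc d)))
  (ℚᵘ.≃-trans (ℚᵘ.*-congˡ (toℚᵘ-inv d)) (ℚᵘ.*-inverseʳ (mkℚᵘ (ℤ.+ suc d) 0)))))

if-nonNeg : ∀ b {x} → NonNegative x → NonNegative (if b then x else 0ℚ)
if-nonNeg true  x≥0 = x≥0
if-nonNeg false _   = _

if-mono-≤ : ∀ b {x y} → x ≤ y → (if b then x else 0ℚ) ≤ (if b then y else 0ℚ)
if-mono-≤ true  x≤y = x≤y
if-mono-≤ false _   = ≤-refl

if-≤ : ∀ b {x y} → (b ≡ true → x ≤ y) → 0ℚ ≤ y → (if b then x else 0ℚ) ≤ y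
if-≤ true  x≤y _   = x≤y refl
if-≤ false _   0≤y = 0≤y

if-≡0 : ∀ b {x} → ¬ b ≡ true → (if b then x else 0ℚ) ≡ 0ℚ
if-≡0 true  b≢true = ⊥-elim (b≢true refl)
if-≡0 false _      = refl

if≡indicator* : ∀ b x → (if b then x else 0ℚ) ≡ toℚ (if b then 1 else 0) * x
if≡indicator* true  x = sym (*-identityˡ x)
if≡indicator* false x = sym (*-zeroˡ x)

sumFin≡∑ : ∀ n (f : Fin n → ℚ) → sumFin n f ≡ ∑[ i < n ] f i
sumFin≡∑ n f = trans (cong (foldr _+_ 0ℚ) (Listₚ.map-tabulate id f)) (foldr-tabulate n f)
  where
  foldr-tabulate : ∀ n (f : Fin n → ℚ) → foldr _+_ 0ℚ (tabulate f) ≡ sum f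
  foldr-tabulate zero    f = refl
  foldr-tabulate (suc n) f = cong (f zero +_) (foldr-tabulate n (f ∘ suc))

∑-mono-≤ : ∀ {n} {f g : Fin n → ℚ} → (∀ i → f i ≤ g i) → sum f ≤ sum g
∑-mono-≤ {zero}  f≤g = ≤-refl
∑-mono-≤ {suc n} f≤g = +-mono-≤ (f≤g zero) (∑-mono-≤ (f≤g ∘ suc))

module _ {n : ℕ} where

  sumFin-cong : ∀ {f g : Fin n → ℚ} → (∀ i → f i ≡ g i) → sumFin n f ≡ sumFin n g
  sumFin-cong f≗g = cong (foldr _+_ 0ℚ) (Listₚ.map-cong f≗g (allFin n))

  sumFin-mono-≤ : ∀ {f g : Fin n → ℚ} → (∀ i → f i ≤ g i) → sumFin n f ≤ sumFin n g
  sumFin-mono-≤ {f} {g} f≤g = subst₂ _≤_ (sym (sumFin≡∑ n f)) (sym (sumFin≡∑ n g)) (∑-mono-≤ f≤g)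

  sumFin-nonNeg : ∀ {f : Fin n → ℚ} → (∀ i → 0ℚ ≤ f i) → 0ℚ ≤ sumFin n f
  sumFin-nonNeg {f} f≥0 =
    subst (_≤ sumFin n f) (trans (sumFin≡∑ n (λ _ → 0ℚ)) (sum-replicate-zero n)) (sumFin-mono-≤ {λ _ → 0ℚ} f≥0)

  sumFin-comm : ∀ (f : Fin n → Fin n → ℚ) →
                sumFin n (λ i → sumFin n (f i)) ≡ sumFin n (λ j → sumFin n (λ i → f i j))
  sumFin-comm f = begin
    sumFin n (λ i → sumFin n (f i))           ≡⟨ sumFin-cong (λ i → sumFin≡∑ n (f i)) ⟩
    sumFin n (λ i → ∑[ j < n ] f i j)         ≡⟨ sumFin≡∑ n _ ⟩
    ∑[ i < n ] ∑[ j < n ] f i j               ≡⟨ ∑-comm f ⟩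
    ∑[ j < n ] ∑[ i < n ] f i j               ≡⟨ sumFin≡∑ n _ ⟨
    sumFin n (λ j → ∑[ i < n ] f i j)         ≡⟨ sumFin-cong (λ j → sumFin≡∑ n (λ i → f i j)) ⟨
    sumFin n (λ j → sumFin n (λ i → f i j))   ∎
    where open ≡-Reasoning

  *-distribˡ-sumFin : ∀ x (f : Fin n → ℚ) → x * sumFin n f ≡ sumFin n (λ i → x * f i)
  *-distribˡ-sumFin x f = begin
    x * sumFin n f             ≡⟨ cong (x *_) (sumFin≡∑ n f) ⟩
    x * sum f                  ≡⟨ *-distribˡ-sum x f ⟩
    ∑[ i < n ] (x * f i)       ≡⟨ sumFin≡∑ n _ ⟨
    sumFin n (λ i → x * f i)   ∎
    where open ≡-Reasoning

  *-distribʳ-sumFin : ∀ x (f : Fin n → ℚ) → sumFin n f * x ≡ sumFin n (λ i → f i * x)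
  *-distribʳ-sumFin x f = begin
    sumFin n f * x             ≡⟨ cong (_* x) (sumFin≡∑ n f) ⟩
    sum f * x                  ≡⟨ *-distribʳ-sum x f ⟩
    ∑[ i < n ] (f i * x)       ≡⟨ sumFin≡∑ n _ ⟨
    sumFin n (λ i → f i * x)   ∎
    where open ≡-Reasoning

  toℚ-sumFinℕ : ∀ (f : Fin n → ℕ) → toℚ (sumFinℕ n f) ≡ sumFin n (toℚ ∘ f)
  toℚ-sumFinℕ f = go (allFin n)
    where
    go : ∀ is → toℚ (foldr ℕ._+_ 0 (map f is)) ≡ foldr _+_ 0ℚ (map (toℚ ∘ f) is)
    go List.[]       = refl
    go (i List.∷ is) = trans (toℚ-homo-+ (f i) _) (cong (toℚ (f i) +_) (go is))

  sumFin-indicator : ∀ (p : Fin n → Bool) x →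
                     sumFin n (λ i → if p i then x else 0ℚ) ≡ toℚ (sumFinℕ n (λ i → if p i then 1 else 0)) * x
  sumFin-indicator p x = begin
    sumFin n (λ i → if p i then x else 0ℚ)                      ≡⟨ sumFin-cong (λ i → if≡indicator* (p i) x) ⟩
    sumFin n (λ i → toℚ (if p i then 1 else 0) * x)             ≡⟨ *-distribʳ-sumFin x _ ⟨
    sumFin n (λ i → toℚ (if p i then 1 else 0)) * x             ≡⟨ cong (_* x) (toℚ-sumFinℕ _) ⟨
    toℚ (sumFinℕ n (λ i → if p i then 1 else 0)) * x            ∎
    where open ≡-Reasoning

sumFin-supported : ∀ {n} (f : Fin n → ℚ) a → (∀ b → ¬ b ≡ a → f b ≡ 0ℚ) → sumFin n f ≡ f a
sumFin-supported {suc n} f a f≡0 = begin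
  sumFin (suc n) f                    ≡⟨ sumFin≡∑ (suc n) f ⟩
  sum f                               ≡⟨ sum-remove f ⟩
  f a + ∑[ j < n ] f (punchIn a j)    ≡⟨ cong (f a +_) (sum-cong-≗ (λ j → f≡0 _ (punchInᵢ≢i a j))) ⟩
  f a + ∑[ j < n ] 0ℚ                 ≡⟨ cong (f a +_) (sum-replicate-zero n) ⟩
  f a + 0ℚ                            ≡⟨ +-identityʳ (f a) ⟩
  f a                                 ∎
  where open ≡-Reasoning

infixl 5 _∷ʳ_

_∷ʳ_ : (Fin m → A) → A → Fin (suc m) → A
_∷ʳ_ {m = zero}  v b = b ∷ v
_∷ʳ_ {m = suc m} v b = head v ∷ (tail v ∷ʳ b)

init-∷ʳ : ∀ (v : Fin m → A) b i → init (v ∷ʳ b) i ≡ v i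
init-∷ʳ {m = suc m} v b zero    = refl
init-∷ʳ {m = suc m} v b (suc i) = init-∷ʳ (tail v) b i

last-∷ʳ : ∀ (v : Fin m → A) b → last (v ∷ʳ b) ≡ b
last-∷ʳ {m = zero}  v b = refl
last-∷ʳ {m = suc m} v b = last-∷ʳ (tail v) b

prodFin-suc : ∀ m (f : Fin (suc m) → ℕ) → prodFin (suc m) f ≡ f zero ℕ.* prodFin m (f ∘ suc)
prodFin-suc m f = cong (foldr ℕ._*_ 1)
  (trans (Listₚ.map-tabulate id f) (cong (f zero List.∷_) (sym (Listₚ.map-tabulate id (f ∘ suc)))))

prodFin-∷ʳ : ∀ (g : A → ℕ) (v : Fin m → A) b → prodFin (suc m) (g ∘ (v ∷ʳ b)) ≡ prodFin m (g ∘ v) ℕ.* g b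
prodFin-∷ʳ {m = zero}  g v b = trans (prodFin-suc 0 (g ∘ (v ∷ʳ b))) (ℕ.*-comm (g b) 1)
prodFin-∷ʳ {m = suc m} g v b = begin
  prodFin (suc (suc m)) (g ∘ (v ∷ʳ b))             ≡⟨ prodFin-suc (suc m) (g ∘ (v ∷ʳ b)) ⟩
  g (v zero) ℕ.* prodFin (suc m) (g ∘ (tail v ∷ʳ b)) ≡⟨ cong (g (v zero) ℕ.*_) (prodFin-∷ʳ g (tail v) b) ⟩
  g (v zero) ℕ.* (prodFin m (g ∘ tail v) ℕ.* g b)    ≡⟨ ℕ.*-assoc (g (v zero)) _ (g b) ⟨
  g (v zero) ℕ.* prodFin m (g ∘ tail v) ℕ.* g b      ≡⟨ cong (ℕ._* g b) (prodFin-suc m (g ∘ v)) ⟨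
  prodFin (suc m) (g ∘ v) ℕ.* g b                    ∎
  where open ≡-Reasoning

module _ {n : ℕ} where

  sumSeq-cong : ∀ m {f g : (Fin m → Fin n) → ℚ} → (∀ u → f u ≡ g u) → sumSeq n m f ≡ sumSeq n m g
  sumSeq-cong zero    f≗g = f≗g _
  sumSeq-cong (suc m) f≗g = sumFin-cong (λ a → sumSeq-cong m (f≗g ∘ (a ∷_)))

  sumSeq-mono-≤ : ∀ m {f g : (Fin m → Fin n) → ℚ} → (∀ u → f u ≤ g u) → sumSeq n m f ≤ sumSeq n m g
  sumSeq-mono-≤ zero    f≤g = f≤g _
  sumSeq-mono-≤ (suc m) f≤g = sumFin-mono-≤ (λ a → sumSeq-mono-≤ m (f≤g ∘ (a ∷_)))

  sumSeq-nonNeg : ∀ m {f : (Fin m → Fin n) → ℚ} → (∀ u → 0ℚ ≤ f u) → 0ℚ ≤ sumSeq n m f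
  sumSeq-nonNeg zero    f≥0 = f≥0 _
  sumSeq-nonNeg (suc m) f≥0 = sumFin-nonNeg (λ a → sumSeq-nonNeg m (f≥0 ∘ (a ∷_)))

  *-distribˡ-sumSeq : ∀ m x (f : (Fin m → Fin n) → ℚ) → x * sumSeq n m f ≡ sumSeq n m (λ u → x * f u)
  *-distribˡ-sumSeq zero    x f = refl
  *-distribˡ-sumSeq (suc m) x f =
    trans (*-distribˡ-sumFin x (λ a → sumSeq n m (f ∘ (a ∷_)))) (sumFin-cong (λ a → *-distribˡ-sumSeq m x (f ∘ (a ∷_))))

  sumSeq-∷ʳ : ∀ m (f : (Fin (suc m) → Fin n) → ℚ) →
              sumSeq n (suc m) f ≡ sumSeq n m (λ v → sumFin n (λ b → f (v ∷ʳ b)))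
  sumSeq-∷ʳ zero    f = refl
  sumSeq-∷ʳ (suc m) f = sumFin-cong (λ a → sumSeq-∷ʳ m (f ∘ (a ∷_)))

data InitOrLast : Fin (suc m) → Set where
  initial : (i : Fin m) → InitOrLast (inject₁ i)
  final   : InitOrLast (fromℕ m)

initOrLast : (i : Fin (suc m)) → InitOrLast i
initOrLast {zero}  zero    = final
initOrLast {suc m} zero    = initial zero
initOrLast {suc m} (suc i) with initOrLast i
... | initial j = initial (suc j)
... | final     = final

toℕ-mod : (i : Fin (suc m)) → toℕ i mod suc m ≡ i
toℕ-mod i = toℕ-injective (trans (toℕ-fromℕ< _) (m<n⇒m%n≡m (toℕ<n i)))

n-mod-n≡0 : ∀ m → suc m mod suc m ≡ zero
n-mod-n≡0 m = toℕ-injective (trans (toℕ-fromℕ< _) (n%n≡0 (suc m)))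

n-mod-1+n≡fromℕ : ∀ m → m mod suc m ≡ fromℕ m
n-mod-1+n≡fromℕ m = subst (λ k → k mod suc m ≡ fromℕ m) (toℕ-fromℕ m) (toℕ-mod (fromℕ m))

∷ʳ-head≡mod : ∀ (u : Fin (suc m) → A) j → (u ∷ʳ head u) j ≡ u (toℕ j mod suc m)
∷ʳ-head≡mod {m} u j with initOrLast j
... | initial i = trans (init-∷ʳ u (head u) i)
                        (cong u (sym (trans (cong (_mod suc m) (toℕ-inject₁ i)) (toℕ-mod i))))
... | final     = trans (last-∷ʳ u (head u))
                        (cong u (sym (trans (cong (_mod suc m) (toℕ-fromℕ (suc m))) (n-mod-n≡0 m))))

allB≡true⇔ : ∀ m (p : Fin m → Bool) → allB m p ≡ true ⇔ (∀ i → p i ≡ true)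
allB≡true⇔ m p = mk⇔
  (λ all≡true i → Equivalence.to T-≡
     (All.lookup (all⁺ p (allFin m) (Equivalence.from T-≡ all≡true)) (∈-allFin i)))
  (λ p≡true → Equivalence.to T-≡
     (all⁻ p {allFin m} (All.tabulate (λ {i} _ → Equivalence.from T-≡ (p≡true i)))))

module _ {n : ℕ} (adj : Fin n → Fin n → Bool) where

  IsWalk : (Fin (suc m) → Fin n) → Set
  IsWalk u = ∀ j → adj (init u j) (tail u j) ≡ true

  at-pred : ∀ (u : Fin (suc m) → Fin n) → at adj u m ≡ last u
  at-pred {m} u = cong u (n-mod-1+n≡fromℕ m)

  at-self : ∀ (u : Fin (suc m) → Fin n) → at adj u (suc m) ≡ head u
  at-self {m} u = cong u (n-mod-n≡0 m)

  isHomCycle⇔closedWalk : ∀ (u : Fin (suc m) → Fin n) → isHomCycle adj u ≡ true ⇔ IsWalk (u ∷ʳ head u)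
  isHomCycle⇔closedWalk {m} u = mk⇔
    (λ cyc j → subst (_≡ true) (edge≡ j) (Equivalence.to (allB≡true⇔ (suc m) _) cyc j))
    (λ walk → Equivalence.from (allB≡true⇔ (suc m) _) (λ j → subst (_≡ true) (sym (edge≡ j)) (walk j)))
    where
    edge≡ : ∀ j → adj (u j) (at adj u (suc (toℕ j))) ≡ adj (init (u ∷ʳ head u) j) (tail (u ∷ʳ head u) j)
    edge≡ j = sym (cong₂ adj (init-∷ʳ u (head u) j) (∷ʳ-head≡mod u (suc j)))

  IsWalk-head : ∀ x (u : Fin (suc m) → Fin n) → IsWalk (x ∷ u) → adj x (head u) ≡ true
  IsWalk-head x u walk = walk zero

  IsWalk-tail : ∀ x (u : Fin (suc m) → Fin n) → IsWalk (x ∷ u) → IsWalk u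
  IsWalk-tail x u walk j = walk (suc j)

  IsWalk-init : ∀ (u : Fin (suc m) → Fin n) x → IsWalk (u ∷ʳ x) → IsWalk u
  IsWalk-init u x walk j = subst₂ (λ y z → adj y z ≡ true)
    (init-∷ʳ u x (inject₁ j)) (init-∷ʳ u x (suc j)) (walk (inject₁ j))

  IsWalk-last : ∀ (u : Fin (suc m) → Fin n) x → IsWalk (u ∷ʳ x) → adj (last u) x ≡ true
  IsWalk-last {m} u x walk = subst₂ (λ y z → adj y z ≡ true)
    (init-∷ʳ u x (fromℕ m)) (last-∷ʳ u x) (walk (fromℕ m))

module _ {n : ℕ} (adj : Fin n → Fin n → Bool) where

  cycleWeight : (Fin (suc m) → Fin n) → ℚ
  cycleWeight u = if isHomCycle adj u then weight adj u else 0ℚ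

  cycleWeight-nonNeg : (u : Fin (suc m) → Fin n) → NonNegative (cycleWeight u)
  cycleWeight-nonNeg {m} u = if-nonNeg (isHomCycle adj u) (inv-nonNeg (prodFin (suc m) (deg adj ∘ u)))

  cycleWeight-cycle : (u : Fin (suc m) → Fin n) → isHomCycle adj u ≡ true → cycleWeight u ≡ weight adj u
  cycleWeight-cycle u cyc = cong (λ b → if b then weight adj u else 0ℚ) cyc

  -- The factor by which a detour v → w → v multiplies the weight of a cycle through v.
  detourWeight : Fin n → Fin n → ℚ
  detourWeight v w = (if adj v w then inv (deg adj w) else 0ℚ) * inv (deg adj v)

  detourWeight-nonNeg : ∀ v w → NonNegative (detourWeight v w)
  detourWeight-nonNeg v w = nonNeg*nonNeg⇒nonNeg (if adj v w then inv (deg adj w) else 0ℚ) {{if-nonNeg (adj v w) (inv-nonNeg (deg adj w))}}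
                                                  (inv (deg adj v)) {{inv-nonNeg (deg adj v)}}

  detourWeight-adj : ∀ {v w} → adj v w ≡ true → detourWeight v w ≡ inv (deg adj w) * inv (deg adj v)
  detourWeight-adj {v} {w} e = cong (λ b → (if b then inv (deg adj w) else 0ℚ) * inv (deg adj v)) e

  weight-detour : ∀ {p} a₀ a₁ (v : Fin p → Fin n) →
                  weight adj (a₀ ∷ a₁ ∷ (v ∷ʳ a₁)) ≡ (inv (deg adj a₀) * inv (deg adj a₁)) * weight adj (a₁ ∷ v)
  weight-detour {p} a₀ a₁ v = begin
    inv (prodFin (3 ℕ.+ p) (deg adj ∘ (a₀ ∷ a₁ ∷ (v ∷ʳ a₁))))  ≡⟨ cong inv prod≡ ⟩
    inv ((d₀ ℕ.* d₁) ℕ.* (d₁ ℕ.* P))                          ≡⟨ inv-homo-* (d₀ ℕ.* d₁) _ ⟩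
    inv (d₀ ℕ.* d₁) * inv (d₁ ℕ.* P)                          ≡⟨ cong₂ _*_ (inv-homo-* d₀ d₁) (cong inv (sym (prodFin-suc p (deg adj ∘ (a₁ ∷ v))))) ⟩
    (inv d₀ * inv d₁) * weight adj (a₁ ∷ v)                   ∎
    where
    open ≡-Reasoning
    d₀ = deg adj a₀
    d₁ = deg adj a₁
    P  = prodFin p (deg adj ∘ v)
    prod≡ : prodFin (3 ℕ.+ p) (deg adj ∘ (a₀ ∷ a₁ ∷ (v ∷ʳ a₁))) ≡ (d₀ ℕ.* d₁) ℕ.* (d₁ ℕ.* P)
    prod≡ = begin
      prodFin (3 ℕ.+ p) (deg adj ∘ (a₀ ∷ a₁ ∷ (v ∷ʳ a₁)))   ≡⟨ prodFin-suc (2 ℕ.+ p) (deg adj ∘ (a₀ ∷ a₁ ∷ (v ∷ʳ a₁))) ⟩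
      d₀ ℕ.* prodFin (2 ℕ.+ p) (deg adj ∘ (a₁ ∷ (v ∷ʳ a₁))) ≡⟨ cong (d₀ ℕ.*_) (prodFin-suc (suc p) (deg adj ∘ (a₁ ∷ (v ∷ʳ a₁)))) ⟩
      d₀ ℕ.* (d₁ ℕ.* prodFin (suc p) (deg adj ∘ (v ∷ʳ a₁))) ≡⟨ cong (λ x → d₀ ℕ.* (d₁ ℕ.* x)) (prodFin-∷ʳ (deg adj) v a₁) ⟩
      d₀ ℕ.* (d₁ ℕ.* (P ℕ.* d₁))                             ≡⟨ cong (λ x → d₀ ℕ.* (d₁ ℕ.* x)) (ℕ.*-comm P d₁) ⟩
      d₀ ℕ.* (d₁ ℕ.* (d₁ ℕ.* P))                             ≡⟨ ℕ.*-assoc d₀ d₁ _ ⟨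
      (d₀ ℕ.* d₁) ℕ.* (d₁ ℕ.* P)                             ∎

  module _ {δ : ℕ} (δ>0 : 0 ℕ.< δ) (δ≤deg : ∀ v → δ ℕ.≤ deg adj v) where

    sumFin-adj-inv≤ : ∀ v → sumFin n (λ w → if adj v w then inv (deg adj w) else 0ℚ) ≤ toℚ (deg adj v) * inv δ
    sumFin-adj-inv≤ v = begin
      sumFin n (λ w → if adj v w then inv (deg adj w) else 0ℚ)
        ≤⟨ sumFin-mono-≤ (λ w → if-mono-≤ (adj v w) (inv-antimono-≤ δ>0 (δ≤deg w))) ⟩
      sumFin n (λ w → if adj v w then inv δ else 0ℚ)
        ≡⟨ sumFin-indicator (adj v) (inv δ) ⟩
      toℚ (deg adj v) * inv δ ∎
      where open ≤-Reasoning

    sumFin-detourWeight≤ : ∀ v → sumFin n (detourWeight v) ≤ inv δ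
    sumFin-detourWeight≤ v = begin
      sumFin n (detourWeight v)
        ≡⟨ *-distribʳ-sumFin (inv d) (λ w → if adj v w then inv (deg adj w) else 0ℚ) ⟨
      sumFin n (λ w → if adj v w then inv (deg adj w) else 0ℚ) * inv d
        ≤⟨ *-monoʳ-≤-nonNeg (inv d) {{inv-nonNeg d}} (sumFin-adj-inv≤ v) ⟩
      (toℚ d * inv δ) * inv d
        ≡⟨ xy∙z≈xz∙y (toℚ d) (inv δ) (inv d) ⟩
      (toℚ d * inv d) * inv δ
        ≤⟨ *-monoʳ-≤-nonNeg (inv δ) {{inv-nonNeg δ}} (toℚ*inv≤1 d) ⟩
      1ℚ * inv δ
        ≡⟨ *-identityˡ (inv δ) ⟩
      inv δ ∎
      where
      open ≤-Reasoning
      d = deg adj v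

module _ {n : ℕ} {adj : Fin n → Fin n → Bool} {c : Fin n → Fin n → ℕ}
         (graph : IsGraph adj) (colouring : IsProperEdgeColouring adj c) where

  open IsGraph graph
  open IsProperEdgeColouring colouring

  sameColour⇒≡ : ∀ {x y z} → adj x y ≡ true → adj z x ≡ true → c x y ≡ c z x → z ≡ y
  sameColour⇒≡ {x} {y} {z} xy zx cxy≡czx with z ≟ y
  ... | yes z≡y = z≡y
  ... | no  z≢y = ⊥-elim (proper x y z xy (symmetric z x zx) (z≢y ∘ sym) (trans cxy≡czx (onEdges z x zx)))

  -- The summand of hPair adj c (3 + p) 1 (3 + p).
  closingCondition : ∀ {p} → (Fin (3 ℕ.+ p) → Fin n) → Bool
  closingCondition {p} u =
    isHomCycle adj u ∧ (c (at adj u (1 ℕ.∸ 1)) (at adj u 1) ℕ.≡ᵇ c (at adj u (3 ℕ.+ p ℕ.∸ 1)) (at adj u (3 ℕ.+ p)))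

  closingSummand : ∀ {p} → (Fin (3 ℕ.+ p) → Fin n) → ℚ
  closingSummand u = if closingCondition u then weight adj u else 0ℚ

  closingCondition⇒detour : ∀ {p} a₀ a₁ (v : Fin p → Fin n) b → closingCondition (a₀ ∷ a₁ ∷ (v ∷ʳ b)) ≡ true →
                            b ≡ a₁ × adj a₁ a₀ ≡ true × IsWalk adj (a₁ ∷ (v ∷ʳ b))
  closingCondition⇒detour a₀ a₁ v b cond = b≡a₁ , symmetric a₀ a₁ a₀a₁ , IsWalk-init adj (a₁ ∷ (v ∷ʳ b)) a₀ walk
    where
    u = a₀ ∷ a₁ ∷ (v ∷ʳ b)
    closedWalk : IsWalk adj (a₀ ∷ ((a₁ ∷ (v ∷ʳ b)) ∷ʳ a₀))
    closedWalk = Equivalence.to (isHomCycle⇔closedWalk adj u) (∧-conicalˡ _ _ cond)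
    walk : IsWalk adj ((a₁ ∷ (v ∷ʳ b)) ∷ʳ a₀)
    walk = IsWalk-tail adj a₀ _ closedWalk
    a₀a₁ : adj a₀ a₁ ≡ true
    a₀a₁ = IsWalk-head adj a₀ _ closedWalk
    ba₀ : adj b a₀ ≡ true
    ba₀ = subst (λ x → adj x a₀ ≡ true) (last-∷ʳ v b) (IsWalk-last adj (a₁ ∷ (v ∷ʳ b)) a₀ walk)
    sameColour : c a₀ a₁ ≡ c b a₀
    sameColour = trans (ℕ.≡ᵇ⇒≡ _ _ (Equivalence.from T-≡ (∧-conicalʳ _ _ cond)))
                       (cong₂ c (trans (at-pred adj u) (last-∷ʳ v b)) (at-self adj u))
    b≡a₁ : b ≡ a₁
    b≡a₁ = sameColour⇒≡ a₀a₁ ba₀ sameColour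

  closingSummand-off : ∀ {p} a₀ a₁ (v : Fin p → Fin n) b → ¬ b ≡ a₁ → closingSummand (a₀ ∷ a₁ ∷ (v ∷ʳ b)) ≡ 0ℚ
  closingSummand-off a₀ a₁ v b b≢a₁ =
    if-≡0 (closingCondition (a₀ ∷ a₁ ∷ (v ∷ʳ b))) (λ cond → b≢a₁ (proj₁ (closingCondition⇒detour a₀ a₁ v b cond)))

  closingSummand-on : ∀ {p} a₀ a₁ (v : Fin p → Fin n) →
                      closingSummand (a₀ ∷ a₁ ∷ (v ∷ʳ a₁)) ≤ detourWeight adj a₁ a₀ * cycleWeight adj (a₁ ∷ v)
  closingSummand-on a₀ a₁ v = if-≤ (closingCondition (a₀ ∷ a₁ ∷ (v ∷ʳ a₁))) onDetour
    (nonNegative⁻¹ _ {{nonNeg*nonNeg⇒nonNeg (detourWeight adj a₁ a₀) {{detourWeight-nonNeg adj a₁ a₀}}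
                                 (cycleWeight adj (a₁ ∷ v)) {{cycleWeight-nonNeg adj (a₁ ∷ v)}}}})
    where
    onDetour : _ ≡ true → weight adj (a₀ ∷ a₁ ∷ (v ∷ʳ a₁)) ≤ detourWeight adj a₁ a₀ * cycleWeight adj (a₁ ∷ v)
    onDetour cond with closingCondition⇒detour a₀ a₁ v a₁ cond
    ... | _ , a₁a₀ , walk = ≤-reflexive (begin
      weight adj (a₀ ∷ a₁ ∷ (v ∷ʳ a₁))
        ≡⟨ weight-detour adj a₀ a₁ v ⟩
      (inv (deg adj a₀) * inv (deg adj a₁)) * weight adj (a₁ ∷ v)
        ≡⟨ cong₂ _*_ (detourWeight-adj adj a₁a₀)
                     (cycleWeight-cycle adj (a₁ ∷ v) (Equivalence.from (isHomCycle⇔closedWalk adj (a₁ ∷ v)) walk)) ⟨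
      detourWeight adj a₁ a₀ * cycleWeight adj (a₁ ∷ v) ∎)
      where open ≡-Reasoning

  closingSum≤ : ∀ {p} a₀ a₁ → sumSeq n (suc p) (λ w → closingSummand (a₀ ∷ a₁ ∷ w))
                            ≤ detourWeight adj a₁ a₀ * sumSeq n p (λ v → cycleWeight adj (a₁ ∷ v))
  closingSum≤ {p} a₀ a₁ = begin
    sumSeq n (suc p) (λ w → closingSummand (a₀ ∷ a₁ ∷ w))
      ≡⟨ sumSeq-∷ʳ p (λ w → closingSummand (a₀ ∷ a₁ ∷ w)) ⟩
    sumSeq n p (λ v → sumFin n (λ b → closingSummand (a₀ ∷ a₁ ∷ (v ∷ʳ b))))
      ≡⟨ sumSeq-cong p (λ v → sumFin-supported _ a₁ (closingSummand-off a₀ a₁ v)) ⟩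
    sumSeq n p (λ v → closingSummand (a₀ ∷ a₁ ∷ (v ∷ʳ a₁)))
      ≤⟨ sumSeq-mono-≤ p (closingSummand-on a₀ a₁) ⟩
    sumSeq n p (λ v → detourWeight adj a₁ a₀ * cycleWeight adj (a₁ ∷ v))
      ≡⟨ *-distribˡ-sumSeq p (detourWeight adj a₁ a₀) (λ v → cycleWeight adj (a₁ ∷ v)) ⟨
    detourWeight adj a₁ a₀ * sumSeq n p (λ v → cycleWeight adj (a₁ ∷ v)) ∎
    where open ≤-Reasoning

  hPair[1,m]≤h[m∸2]*invδ : ∀ {δ} → 0 ℕ.< δ → (∀ v → δ ℕ.≤ deg adj v) →
                           ∀ m → 3 ℕ.≤ m → hPair adj c m 1 m ≤ h adj (m ℕ.∸ 2) * inv δ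
  hPair[1,m]≤h[m∸2]*invδ {δ} δ>0 δ≤deg (suc (suc (suc p))) (s≤s (s≤s (s≤s z≤n))) = begin
    hPair adj c (3 ℕ.+ p) 1 (3 ℕ.+ p)
      ≡⟨⟩
    sumFin n (λ a₀ → sumFin n (λ a₁ → sumSeq n (suc p) (λ w → closingSummand (a₀ ∷ a₁ ∷ w))))
      ≤⟨ sumFin-mono-≤ (λ a₀ → sumFin-mono-≤ (closingSum≤ {p} a₀)) ⟩
    sumFin n (λ a₀ → sumFin n (λ a₁ → detourWeight adj a₁ a₀ * S a₁))
      ≡⟨ sumFin-comm (λ a₀ a₁ → detourWeight adj a₁ a₀ * S a₁) ⟩
    sumFin n (λ a₁ → sumFin n (λ a₀ → detourWeight adj a₁ a₀ * S a₁))
      ≡⟨ sumFin-cong (λ a₁ → *-distribʳ-sumFin (S a₁) (detourWeight adj a₁)) ⟨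
    sumFin n (λ a₁ → sumFin n (detourWeight adj a₁) * S a₁)
      ≤⟨ sumFin-mono-≤ (λ a₁ → *-monoʳ-≤-nonNeg (S a₁) {{nonNegative (S-nonNeg a₁)}}
                                  (sumFin-detourWeight≤ adj δ>0 δ≤deg a₁)) ⟩
    sumFin n (λ a₁ → inv δ * S a₁)
      ≡⟨ *-distribˡ-sumFin (inv δ) S ⟨
    inv δ * h adj (suc p)
      ≡⟨ *-comm (inv δ) _ ⟩
    h adj (suc p) * inv δ ∎
    where
    open ≤-Reasoning
    S : Fin n → ℚ
    S a₁ = sumSeq n p (λ v → cycleWeight adj (a₁ ∷ v))
    S-nonNeg : ∀ a₁ → 0ℚ ≤ S a₁
    S-nonNeg a₁ = sumSeq-nonNeg p (λ v → nonNegative⁻¹ _ {{cycleWeight-nonNeg adj (a₁ ∷ v)}})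

lemma3p6 : {n : ℕ} (adj : Fin n → Fin n → Bool) (c : Fin n → Fin n → ℕ) →
    IsGraph adj → IsProperEdgeColouring adj c →
    (δ : ℕ) → IsMinDegree adj δ → 0 ℕ.< δ →
    (k : ℕ) → 2 ℕ.≤ k →
    Data.Rational._≤_ (hPair adj c (2 ℕ.* k) 1 (2 ℕ.* k))
                      (Data.Rational._*_ (h adj (2 ℕ.* k ℕ.∸ 2)) (inv δ))
lemma3p6 adj c graph colouring δ minDegree δ>0 k 2≤k =
  hPair[1,m]≤h[m∸2]*invδ graph colouring δ>0 (proj₂ minDegree) (2 ℕ.* k)
    (ℕ.≤-trans (ℕ.n≤1+n 3) (ℕ.*-monoʳ-≤ 2 2≤k))
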